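{- Let $j\ge 1$ be an integer and let $G_j$ be the undirected graph obtained from a path $x'xyy'$ by adding vertices $z_1,\dots,z_j$, each adjacent to both $x$ and $y$, and, for each $i\in\{1,\dots,j\}$, a new vertex $z_i'$ adjacent only to $z_i$. Then $mag^-(G_j)=j+3$.
   Context: For an oriented graph $\vec G$, two distinct vertices $x,y$ monitor an arc $a$ if $a$ lies on every shortest directed path from $x$ to $y$, or on every shortest directed path from $y$ to $x$. A monitoring arc-geodetic set (MAG-set) is a vertex set $M$ such that every arc is monitored by some pair of distinct vertices of $M$; $mag(\vec G)$ is the minimum size of an MAG-set. For an undirected graph $G$, $mag^-(G)$ is the minimum of $mag(\vec G)$ over all orientations $\vec G$ of $G$. -}

module Defs where

open import Data.Nat using (ℕ; zero; suc; _≤_; _<_; _+_)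
open import Data.Fin using (Fin)
open import Data.Bool using (Bool; true)
open import Data.Product using (Σ; _×_; ∃; ∃-syntax)
open import Data.Sum using (_⊎_)
open import Data.List using (List; length)
open import Data.List.Membership.Propositional using (_∈_)
open import Data.List.Relation.Unary.Unique.Propositional using (Unique)
open import Relation.Binary.PropositionalEquality using (_≡_; _≢_)
open import Relation.Nullary using (¬_)

-- An undirected graph on a vertex type V is given by an adjacency
-- relation E (assumed symmetric, as for G_j below).
Arc : {V : Set} → (V → V → Bool) → V → V → Set
Arc O u v = O u v ≡ true

record IsOrientation {V : Set} (E : V → V → Set) (O : V → V → Bool) : Set where
  field
    arc⇒edge : ∀ u v → Arc O u v → E u v
    edge⇒arc : ∀ u v → E u v → Arc O u v ⊎ Arc O v u
    antisym  : ∀ u v → Arc O u v → ¬ Arc O v u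

data Walk {V : Set} (O : V → V → Bool) : V → V → ℕ → Set where
  []  : ∀ {u} → Walk O u u 0
  _∷_ : ∀ {u v w k} → Arc O u v → Walk O v w k → Walk O u w (suc k)

data ArcOn {V : Set} {O : V → V → Bool} (a b : V) :
           ∀ {u w k} → Walk O u w k → Set where
  here  : ∀ {w k} (d : Arc O a b) (p : Walk O b w k) → ArcOn a b (d ∷ p)
  there : ∀ {u v w k} (d : Arc O u v) {p : Walk O v w k} →
          ArcOn a b p → ArcOn a b (d ∷ p)

-- a shortest directed path from u to w (a walk of minimum length;
-- minimum-length walks are automatically paths)
IsShortest : {V : Set} {O : V → V → Bool} {u w : V} {k : ℕ} →
             Walk O u w k → Set
IsShortest {V} {O} {u} {w} {k} _ = ∀ {k'} → Walk O u w k' → k ≤ k'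

OnAllShortest : {V : Set} (O : V → V → Bool) (x y a b : V) → Set
OnAllShortest O x y a b =
  (∃[ k ] Walk O x y k) ×
  (∀ k (p : Walk O x y k) → IsShortest p → ArcOn a b p)

Monitors : {V : Set} (O : V → V → Bool) (x y a b : V) → Set
Monitors O x y a b =
  x ≢ y × (OnAllShortest O x y a b ⊎ OnAllShortest O y x a b)

IsMAG : {V : Set} (O : V → V → Bool) (M : List V) → Set
IsMAG {V} O M =
  ∀ a b → Arc O a b →
    Σ V λ x → Σ V λ y → x ∈ M × y ∈ M × Monitors O x y a b

MagMinusIs : {V : Set} (E : V → V → Set) (n : ℕ) → Set
MagMinusIs {V} E n =
  (Σ (V → V → Bool) λ O → IsOrientation E O ×
     Σ (List V) λ M → Unique M × length M ≡ n × IsMAG O M)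
  ×
  (∀ (O : V → V → Bool) → IsOrientation E O →
     ∀ (M : List V) → Unique M → IsMAG O M → n ≤ length M)

data GV (j : ℕ) : Set where
  x' x y y' : GV j
  z z'      : Fin j → GV j

data GBase {j : ℕ} : GV j → GV j → Set where
  x'x  : GBase x' x
  xy   : GBase x y
  yy'  : GBase y y'
  xz   : ∀ i → GBase x (z i)
  zy   : ∀ i → GBase (z i) y
  zz'  : ∀ i → GBase (z i) (z' i)

GE : (j : ℕ) → GV j → GV j → Set
GE j u v = GBase u v ⊎ GBase v u

-- Upper bound: orient x' → x → y → y', x → zᵢ → z'ᵢ, z₀ → y and y → zᵢ for i ≠ 0. Then every
-- arc lies on all shortest paths between two of x', y', z₀, z'₀, …, z'ⱼ₋₁.
--
-- Lower bound: a geodesic through a pendant arc starts or ends at the leaf, so the j + 2 leaves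
-- lie in every MAG-set M, and it remains to show that M meets x, y, z₀, …, zⱼ₋₁. Otherwise every
-- arc is monitored by two leaves, so a geodesic through an arc between two of these vertices
-- extends beyond both ends of the arc, and the segment around the arc is again a geodesic such
-- that every walk between its ends of no greater length uses the arc. Reversing all arcs preserves MAG-sets, so we may assume x → y.
-- Testing such segments against shortcuts and detours shows: x → zᵢ forces y → zᵢ and y' → y;
-- zᵢ → x, zᵢ → y forces x → x'; a directed triangle x → y → zᵢ → x forces x → x' if zᵢ → z'ᵢ
-- and y' → y if z'ᵢ → zᵢ; y' → y produces a triangle of the first kind, x → x' one of the second,
-- and the two kinds exclude each other. Each orientation of xx' and yy' is thus contradictory.

module Submission where

open import Defs
open import Data.Bool using (Bool; true; false; T)
import Data.Bool.Properties as Bool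
open import Data.Empty using (⊥; ⊥-elim)
open import Data.Fin using (Fin; zero; suc)
import Data.Fin.Properties as Fin
open import Data.List using (List; []; _∷_; length; map; _++_; allFin)
open import Data.List.Membership.Propositional using (_∈_; lose; find)
open import Data.List.Membership.Propositional.Properties
  using (∈-map⁺; ∈-map⁻; ∈-++⁺ˡ; ∈-++⁺ʳ; ∈-allFin)
open import Data.List.Properties using (length-map; length-tabulate)
open import Data.List.Relation.Unary.All using (_∷_)
import Data.List.Relation.Unary.All as All
import Data.List.Relation.Unary.All.Properties as All
open import Data.List.Relation.Unary.AllPairs using (_∷_)
open import Data.List.Relation.Unary.Any using (here; there; any?; satisfied)
open import Data.List.Relation.Unary.Unique.Propositional using (Unique)
import Data.List.Relation.Unary.Unique.Propositional.Properties as Unique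
open import Data.Nat using (ℕ; zero; suc; _+_; _≤_; _<_; _≤ᵇ_; _<ᵇ_; z≤n; s≤s; z<s)
open import Data.Nat.Induction using (<-rec)
open import Data.Nat.Properties hiding (_≟_)
open import Data.Nat.Solver using (module +-*-Solver)
open import Data.Product using (Σ; ∃-syntax; _×_; _,_)
open import Data.Sum using (_⊎_; inj₁; inj₂; swap)
import Data.Sum as Sum
import Data.Sum.Properties as Sum
open import Function using (flip; _∘_)
open import Relation.Binary using (DecidableEquality; Symmetric)
open import Relation.Binary.PropositionalEquality
  using (_≡_; _≢_; refl; sym; trans; cong; subst; module ≡-Reasoning)
open import Relation.Nullary using (¬_; Dec; yes; no; does)
open import Relation.Nullary.Decidable using (map′; _×-dec_; dec-true)

private variable
  V : Set
  O : V → V → Bool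
  a b c s t u v w : V
  k m n : ℕ

-- Walks

infixr 5 _++ʷ_
infixl 5 _∷ʳ_

_++ʷ_ : Walk O a b m → Walk O b c n → Walk O a c (m + n)
[]      ++ʷ q = q
(d ∷ p) ++ʷ q = d ∷ (p ++ʷ q)

_∷ʳ_ : Walk O a b k → Arc O b c → Walk O a c (suc k)
[]      ∷ʳ e = e ∷ []
(d ∷ p) ∷ʳ e = d ∷ (p ∷ʳ e)

data SnocView {O : V → V → Bool} {a : V} : ∀ {b k} → Walk O a b k → Set where
  []   : SnocView []
  snoc : (p : Walk O a b k) (e : Arc O b c) → SnocView (p ∷ʳ e)

snocView : (p : Walk O a b k) → SnocView p
snocView []      = []
snocView (d ∷ p) with snocView p
... | []       = snoc [] d
... | snoc q e = snoc (d ∷ q) e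

reverse : Walk O a b k → Walk (flip O) b a k
reverse []      = []
reverse (d ∷ p) = reverse p ∷ʳ d

reverse-∷ʳ : (p : Walk O a b k) (e : Arc O b c) → reverse (p ∷ʳ e) ≡ e ∷ reverse p
reverse-∷ʳ []      e = refl
reverse-∷ʳ (d ∷ p) e = cong (_∷ʳ d) (reverse-∷ʳ p e)

reverse-involutive : (p : Walk O a b k) → reverse (reverse p) ≡ p
reverse-involutive []      = refl
reverse-involutive (d ∷ p) =
  trans (reverse-∷ʳ (reverse p) d) (cong (d ∷_) (reverse-involutive p))

walk-to-source : (∀ {v} → ¬ Arc O v u) → Walk O s u k → s ≡ u
walk-to-source source p with snocView p
... | []       = refl
... | snoc _ e = ⊥-elim (source e)

walk-from-sink : (∀ {v} → ¬ Arc O u v) → Walk O u t k → t ≡ u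
walk-from-sink sink []      = refl
walk-from-sink sink (d ∷ _) = ⊥-elim (sink d)

ArcOn-++⁻ : (p : Walk O a b m) {q : Walk O b c n} →
            ArcOn u w (p ++ʷ q) → ArcOn u w p ⊎ ArcOn u w q
ArcOn-++⁻ []      r           = inj₂ r
ArcOn-++⁻ (d ∷ p) (here _ _)  = inj₁ (here d p)
ArcOn-++⁻ (d ∷ p) (there _ r) = Sum.map₁ (there d) (ArcOn-++⁻ p r)

ArcOn-split : {p : Walk O a b k} → ArcOn u w p →
              ∃[ l₁ ] ∃[ l₂ ] Walk O a u l₁ × Walk O w b l₂ × l₁ + suc l₂ ≡ k
ArcOn-split (here _ p)  = 0 , _ , [] , p , refl
ArcOn-split (there d r) with l₁ , l₂ , p , q , eq ← ArcOn-split r =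
  suc l₁ , l₂ , d ∷ p , q , cong suc eq

ArcOn-∷ʳ : {p : Walk O a b k} {e : Arc O b c} → ArcOn u w p → ArcOn u w (p ∷ʳ e)
ArcOn-∷ʳ (here d p)  = here d (p ∷ʳ _)
ArcOn-∷ʳ (there d r) = there d (ArcOn-∷ʳ r)

ArcOn-last : (p : Walk O a u k) (e : Arc O u w) → ArcOn u w (p ∷ʳ e)
ArcOn-last []      e = here e []
ArcOn-last (d ∷ p) e = there d (ArcOn-last p e)

ArcOn-reverse : {p : Walk O a b k} → ArcOn u w p → ArcOn w u (reverse p)
ArcOn-reverse (here d p)  = ArcOn-last (reverse p) d
ArcOn-reverse (there d r) = ArcOn-∷ʳ (ArcOn-reverse r)

ArcOn-start : (∀ {v} → Arc O a v → v ≡ b) → (p : Walk O a t k) → a ≢ t → ArcOn a b p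
ArcOn-start out []      a≢t = ⊥-elim (a≢t refl)
ArcOn-start out (d ∷ p) _ with refl ← out d = here d p

ArcOn-end : (∀ {v} → Arc O v t → v ≡ c) → (p : Walk O s t k) → s ≢ t → ArcOn c t p
ArcOn-end into p s≢t with snocView p
... | []       = ⊥-elim (s≢t refl)
... | snoc q e with refl ← into e = ArcOn-last q e

-- Geodesics and monitoring

OnAllShortest-intro : (p : Walk O s t k) →
                      (∀ {n} (q : Walk O s t n) → n ≤ k → ArcOn a b q) →
                      OnAllShortest O s t a b
OnAllShortest-intro p through = (_ , p) , λ _ q q-shortest → through q (q-shortest p)

record Monitoring (O : V → V → Bool) (s t u w : V) (k : ℕ) : Set where
  field
    shortest : ∀ {n} → Walk O s t n → k ≤ n
    through  : ∀ {n} (q : Walk O s t n) → n ≤ k → ArcOn u w q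

  too-short : Walk O s t n → n < k → ⊥
  too-short q n<k = <⇒≱ n<k (shortest q)

  -- The side conditions are booleans, so that on numerals they are discharged by computation.
  shortcut : Walk O s t n → {T (n <ᵇ k)} → ⊥
  shortcut q {n<k} = too-short q (<ᵇ⇒< _ _ n<k)

  detour : (q : Walk O s t n) → {T (n ≤ᵇ k)} → ArcOn u w q
  detour q {n≤k} = through q (≤ᵇ⇒≤ _ _ n≤k)

open Monitoring

-- A walk replacing the segment P₂ · (u → w) · Q₁ of P₁ · P₂ · (u → w) · Q₁ · Q₂ yields a walk
-- replacing the whole; the arc cannot reappear inside P₁ or Q₂, as that would give a shortcut.
window : ∀ {O : V → V → Bool} {s t u w a b k₁ k₂ m₁ m₂ n₁ n₂} →
         Monitoring O s t u w (k₁ + suc k₂) →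
         Walk O s a m₁ → Walk O a u m₂ → Arc O u w → Walk O w b n₁ → Walk O b t n₂ →
         m₁ + m₂ ≡ k₁ → n₁ + n₂ ≡ k₂ → Monitoring O a b u w (m₂ + suc n₁)
window {O = O} {s} {t} {u} {w} {a} {b} {m₁ = m₁} {m₂} {n₁} {n₂} g P₁ P₂ d Q₁ Q₂ refl refl =
  record
  { shortest = λ {n} R → +-cancelʳ-≤ n₂ _ _ (+-cancelˡ-≤ m₁ _ _
      (subst (_≤ m₁ + (n + n₂)) total (shortest g (P₁ ++ʷ R ++ʷ Q₂))))
  ; through  = through′
  }
  where
  open +-*-Solver
  total : m₁ + m₂ + suc (n₁ + n₂) ≡ m₁ + (m₂ + suc n₁ + n₂)
  total = solve 4 (λ m₁ m₂ n₁ n₂ → m₁ :+ m₂ :+ (con 1 :+ (n₁ :+ n₂))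
                               := m₁ :+ (m₂ :+ (con 1 :+ n₁) :+ n₂)) refl m₁ m₂ n₁ n₂

  not-in-P₁ : ArcOn u w P₁ → ⊥
  not-in-P₁ r with l₁ , _ , A , _ , refl ← ArcOn-split r =
    too-short g (A ++ʷ d ∷ Q₁ ++ʷ Q₂)
      (+-monoˡ-< (suc (n₁ + n₂)) (<-≤-trans (m<m+n l₁ z<s) (m≤m+n _ m₂)))

  not-in-Q₂ : ArcOn u w Q₂ → ⊥
  not-in-Q₂ r with l₁ , l₂ , _ , B , refl ← ArcOn-split r =
    too-short g ((P₁ ++ʷ P₂) ++ʷ d ∷ B)
      (+-monoʳ-< (m₁ + m₂) (s≤s (≤-trans (m≤n+m (suc l₂) l₁) (m≤n+m _ n₁))))

  through′ : (R : Walk O a b n) → n ≤ m₂ + suc n₁ → ArcOn u w R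
  through′ {n} R n≤ with ArcOn-++⁻ P₁ (through g (P₁ ++ʷ R ++ʷ Q₂)
    (subst (m₁ + (n + n₂) ≤_) (sym total) (+-monoʳ-≤ m₁ (+-monoˡ-≤ n₂ n≤))))
  ... | inj₁ r = ⊥-elim (not-in-P₁ r)
  ... | inj₂ r with ArcOn-++⁻ R r
  ...   | inj₁ r′ = r′
  ...   | inj₂ r′ = ⊥-elim (not-in-Q₂ r′)

record Monitored (O : V → V → Bool) (s t u w : V) : Set where
  constructor monitored
  field
    {k₁ k₂}    : ℕ
    pre        : Walk O s u k₁
    arc        : Arc O u w
    post       : Walk O w t k₂
    monitoring : Monitoring O s t u w (k₁ + suc k₂)

step-before : Monitored O s t u w → s ≢ u → ∃[ p ] Arc O p u × Monitoring O p w u w 2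
step-before (monitored pre d post g) s≢u with snocView pre
... | []          = ⊥-elim (s≢u refl)
... | snoc pre′ e = _ , e , window g pre′ (e ∷ []) d [] post (+-comm _ 1) refl

step-after : Monitored O s t u w → t ≢ w → ∃[ q ] Arc O w q × Monitoring O u q u w 2
step-after (monitored _   _ []          _) t≢w = ⊥-elim (t≢w refl)
step-after (monitored pre d (e ∷ post′) g) _   =
  _ , e , window g pre [] d (e ∷ []) post′ (+-identityʳ _) refl

steps-around : Monitored O s t u w → s ≢ u → t ≢ w →
               ∃[ p ] ∃[ q ] Arc O p u × Arc O w q × Monitoring O p q u w 3
steps-around (monitored pre d post g) s≢u t≢w with snocView pre | post
... | []          | _         = ⊥-elim (s≢u refl)
... | snoc _ _    | []        = ⊥-elim (t≢w refl)
... | snoc pre′ e | f ∷ post′ =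
  _ , _ , e , f , window g pre′ (e ∷ []) d (f ∷ []) post′ (+-comm _ 1) refl

two-steps-before : Monitored O s t u w → s ≢ u →
                   ∃[ p ] Arc O p u × (s ≡ p ⊎ ∃[ r ] Arc O r p × Monitoring O r w u w 3)
two-steps-before (monitored pre d post g) s≢u with snocView pre
... | []          = ⊥-elim (s≢u refl)
... | snoc pre′ e with snocView pre′
...   | []          = _ , e , inj₁ refl
...   | snoc pre″ f =
  _ , e , inj₂ (_ , f , window g pre″ (f ∷ e ∷ []) d [] post (+-comm _ 2) refl)

two-steps-after : Monitored O s t u w → t ≢ w →
                  ∃[ q ] Arc O w q × (t ≡ q ⊎ ∃[ r ] Arc O q r × Monitoring O u r u w 3)
two-steps-after (monitored _   _ []              _) t≢w = ⊥-elim (t≢w refl)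
two-steps-after (monitored _   _ (e ∷ [])        _) _   = _ , e , inj₁ refl
two-steps-after (monitored pre d (e ∷ f ∷ post′) g) _   =
  _ , e , inj₂ (_ , f , window g pre [] d (e ∷ f ∷ []) post′ (+-identityʳ _) refl)

module _ {V : Set} (_≟_ : DecidableEquality V) {vertices : List V}
         (complete : ∀ v → v ∈ vertices) {O : V → V → Bool} where

  walk? : ∀ n a b → Dec (Walk O a b n)
  walk? zero    a b = map′ (λ { refl → [] }) (λ { [] → refl }) (a ≟ b)
  walk? (suc n) a b =
    map′ (λ first → let _ , d , p = satisfied {P = λ v → Arc O a v × Walk O v b n} first
                    in d ∷ p)
         (λ { (d ∷ p) → lose (complete _) (d , p) })
         (any? (λ v → (O a v Bool.≟ true) ×-dec walk? n v b) vertices)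

  ShortestWalk : V → V → Set
  ShortestWalk a b = ∃[ n ] Σ (Walk O a b n) IsShortest

  shortestWalk : Walk O a b k → ShortestWalk a b
  shortestWalk {a = a} {b = b} {k = k} = <-rec (λ k → Walk O a b k → ShortestWalk a b) shorten k
    where
    shorten : ∀ k → (∀ {m} → m < k → Walk O a b m → ShortestWalk a b) →
              Walk O a b k → ShortestWalk a b
    shorten k shorter p with anyUpTo? (λ n → walk? n a b) k
    ... | yes (m , m<k , q) = shorter m<k q
    ... | no  none          = k , p , λ q → ≮⇒≥ λ lt → none (_ , lt , q)

  OnAllShortest⇒Monitored : OnAllShortest O s t u w → Arc O u w → Monitored O s t u w
  OnAllShortest⇒Monitored ((_ , p₀) , all) d
    with n , p , p-shortest ← shortestWalk p₀
    with _ , _ , pre , post , refl ← ArcOn-split (all n p p-shortest) =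
    monitored pre d post record
      { shortest = p-shortest
      ; through  = λ q q≤ → all _ q λ r → ≤-trans q≤ (p-shortest r)
      }

  monitoredIn : ∀ {M} → IsMAG O M → Arc O u w →
                ∃[ s ] ∃[ t ] s ∈ M × t ∈ M × Monitored O s t u w
  monitoredIn mag d with mag _ _ d
  ... | s , t , s∈ , t∈ , _ , inj₁ st = s , t , s∈ , t∈ , OnAllShortest⇒Monitored st d
  ... | s , t , s∈ , t∈ , _ , inj₂ ts = t , s , t∈ , s∈ , OnAllShortest⇒Monitored ts d

OnAllShortest-flip : OnAllShortest O s t a b → OnAllShortest (flip O) t s b a
OnAllShortest-flip ((k , p) , all) =
  (k , reverse p) , λ n q q-shortest →
    subst (ArcOn _ _) (reverse-involutive q)
          (ArcOn-reverse (all n (reverse q) (q-shortest ∘ reverse)))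

IsMAG-flip : ∀ {M} → IsMAG O M → IsMAG (flip O) M
IsMAG-flip mag a b d with s , t , s∈ , t∈ , s≢t , on ← mag b a d =
  s , t , s∈ , t∈ , s≢t , swap (Sum.map OnAllShortest-flip OnAllShortest-flip on)

IsOrientation-flip : ∀ {E : V → V → Set} → Symmetric E →
                     IsOrientation E O → IsOrientation E (flip O)
IsOrientation-flip sym-E orientation = record
  { arc⇒edge = λ u v d → sym-E (arc⇒edge v u d)
  ; edge⇒arc = λ u v e → swap (edge⇒arc u v e)
  ; antisym  = λ u v d e → antisym v u d e
  }
  where open IsOrientation orientation

source-of-pendant : ∀ {E : V → V → Set} → IsOrientation E O →
                    (∀ {v} → E v a → v ≡ c) → Arc O a c → ∀ {v} → ¬ Arc O v a
source-of-pendant orientation only-c a⟶c v⟶a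
  with refl ← only-c (IsOrientation.arc⇒edge orientation _ _ v⟶a) =
  IsOrientation.antisym orientation _ _ a⟶c v⟶a

sink-of-pendant : ∀ {E : V → V → Set} → IsOrientation E O →
                  (∀ {v} → E a v → v ≡ c) → Arc O c a → ∀ {v} → ¬ Arc O a v
sink-of-pendant orientation only-c c⟶a a⟶v
  with refl ← only-c (IsOrientation.arc⇒edge orientation _ _ a⟶v) =
  IsOrientation.antisym orientation _ _ c⟶a a⟶v

remove-∈ : ∀ {A : Set} {a : A} {xs} → a ∈ xs →
           ∃[ ys ] length xs ≡ suc (length ys) × (∀ {v} → v ∈ xs → v ≢ a → v ∈ ys)
remove-∈ {xs = _ ∷ ys} (here refl) = ys , refl , λ where
  (here refl) v≢a → ⊥-elim (v≢a refl)
  (there v∈)  _   → v∈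
remove-∈ {xs = b ∷ _} (there a∈) with ys , eq , keep ← remove-∈ a∈ =
  b ∷ ys , cong suc eq , λ where
    (here refl) _   → here refl
    (there v∈)  v≢a → there (keep v∈ v≢a)

Unique⇒length≤ : ∀ {A : Set} {xs ys : List A} →
                 Unique xs → (∀ {v} → v ∈ xs → v ∈ ys) → length xs ≤ length ys
Unique⇒length≤ {xs = []}     _            _   = z≤n
Unique⇒length≤ {xs = a ∷ xs} (a∉xs ∷ uxs) sub with _ , eq , keep ← remove-∈ (sub (here refl)) =
  subst (suc (length xs) ≤_) (sym eq)
        (s≤s (Unique⇒length≤ uxs λ v∈ → keep (sub (there v∈)) λ { refl → All.lookup a∉xs v∈ refl }))

-- The graph G_j

private variable
  j : ℕ
  i : Fin j

data Leaf {j} : GV j → Set where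
  lx' : Leaf x'
  ly' : Leaf y'
  lz' : ∀ i → Leaf (z' i)

data Core {j} : GV j → Set where
  cx : Core x
  cy : Core y
  cz : ∀ i → Core (z i)

leaf-or-core : (v : GV j) → Leaf v ⊎ Core v
leaf-or-core x'     = inj₁ lx'
leaf-or-core x      = inj₂ cx
leaf-or-core y      = inj₂ cy
leaf-or-core y'     = inj₁ ly'
leaf-or-core (z i)  = inj₂ (cz i)
leaf-or-core (z' i) = inj₁ (lz' i)

leaf≢core : {a b : GV j} → Leaf a → Core b → a ≢ b
leaf≢core lx'     () refl
leaf≢core ly'     () refl
leaf≢core (lz' _) () refl

stem : {v : GV j} → Leaf v → GV j
stem lx'     = x
stem ly'     = y
stem (lz' i) = z i

stem-edge : {v : GV j} (ℓ : Leaf v) → GE j v (stem ℓ)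
stem-edge lx'     = inj₁ x'x
stem-edge ly'     = inj₂ yy'
stem-edge (lz' i) = inj₂ (zz' i)

stem-unique : {v w : GV j} (ℓ : Leaf v) → GE j v w → w ≡ stem ℓ
stem-unique lx'     (inj₁ x'x)      = refl
stem-unique ly'     (inj₂ yy')      = refl
stem-unique (lz' i) (inj₂ (zz' i))  = refl

neighbours-x : {v : GV j} → GE j x v → v ≡ x' ⊎ v ≡ y ⊎ ∃[ i ] v ≡ z i
neighbours-x (inj₂ x'x)     = inj₁ refl
neighbours-x (inj₁ xy)      = inj₂ (inj₁ refl)
neighbours-x (inj₁ (xz i))  = inj₂ (inj₂ (i , refl))

neighbours-y : {v : GV j} → GE j y v → v ≡ y' ⊎ v ≡ x ⊎ ∃[ i ] v ≡ z i
neighbours-y (inj₁ yy')     = inj₁ refl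
neighbours-y (inj₂ xy)      = inj₂ (inj₁ refl)
neighbours-y (inj₂ (zy i))  = inj₂ (inj₂ (i , refl))

neighbours-z : {v : GV j} → GE j (z i) v → v ≡ x ⊎ v ≡ y ⊎ v ≡ z' i
neighbours-z (inj₂ (xz i))  = inj₁ refl
neighbours-z (inj₁ (zy i))  = inj₂ (inj₁ refl)
neighbours-z (inj₁ (zz' i)) = inj₂ (inj₂ refl)

code : GV j → Fin 4 ⊎ Fin j ⊎ Fin j
code x'     = inj₁ zero
code x      = inj₁ (suc zero)
code y      = inj₁ (suc (suc zero))
code y'     = inj₁ (suc (suc (suc zero)))
code (z i)  = inj₂ (inj₁ i)
code (z' i) = inj₂ (inj₂ i)

decode : Fin 4 ⊎ Fin j ⊎ Fin j → GV j
decode (inj₁ zero)                   = x'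
decode (inj₁ (suc zero))             = x
decode (inj₁ (suc (suc zero)))       = y
decode (inj₁ (suc (suc (suc zero)))) = y'
decode (inj₂ (inj₁ i))               = z i
decode (inj₂ (inj₂ i))               = z' i

decode-code : (v : GV j) → decode (code v) ≡ v
decode-code x'     = refl
decode-code x      = refl
decode-code y      = refl
decode-code y'     = refl
decode-code (z _)  = refl
decode-code (z' _) = refl

_≟ᵥ_ : DecidableEquality (GV j)
u ≟ᵥ v = map′ code-injective (cong code) (code u ≟ code v)
  where
  _≟_ : DecidableEquality (Fin 4 ⊎ Fin _ ⊎ Fin _)
  _≟_ = Sum.≡-dec Fin._≟_ (Sum.≡-dec Fin._≟_ Fin._≟_)
  code-injective : code u ≡ code v → u ≡ v
  code-injective eq = trans (sym (decode-code u)) (trans (cong decode eq) (decode-code v))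

vertices : ∀ j → List (GV j)
vertices j = x' ∷ x ∷ y ∷ y' ∷ map z (allFin j) ++ map z' (allFin j)

∈-vertices : (v : GV j) → v ∈ vertices j
∈-vertices x'     = here refl
∈-vertices x      = there (here refl)
∈-vertices y      = there (there (here refl))
∈-vertices y'     = there (there (there (here refl)))
∈-vertices (z i)  = there (there (there (there (∈-++⁺ˡ (∈-map⁺ z (∈-allFin i))))))
∈-vertices {j} (z' i) =
  there (there (there (there (∈-++⁺ʳ (map z (allFin j)) (∈-map⁺ z' (∈-allFin i))))))

leaves : ∀ j → List (GV j)
leaves j = x' ∷ y' ∷ map z' (allFin j)

leaves-Leaf : {v : GV j} → v ∈ leaves j → Leaf v
leaves-Leaf (here refl)         = lx'
leaves-Leaf (there (here refl)) = ly'
leaves-Leaf (there (there v∈)) with i , _ , refl ← ∈-map⁻ z' v∈ = lz' i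

Leaf-∈-leaves : {v : GV j} → Leaf v → v ∈ leaves j
Leaf-∈-leaves lx'     = here refl
Leaf-∈-leaves ly'     = there (here refl)
Leaf-∈-leaves (lz' i) = there (there (∈-map⁺ z' (∈-allFin i)))

Unique-∷-leaves : {c : GV j} → Core c → Unique (c ∷ leaves j)
Unique-∷-leaves {j} core = All.tabulate (λ v∈ → leaf≢core (leaves-Leaf v∈) core ∘ sym)
                         ∷ ((λ ()) ∷ All.map⁺ (All.universal (λ _ ()) _))
                         ∷ All.map⁺ (All.universal (λ _ ()) _)
                         ∷ Unique.map⁺ z'-injective (Unique.allFin⁺ j)
  where
  z'-injective : {i k : Fin j} → z' i ≡ z' k → i ≡ k
  z'-injective refl = refl

length-∷-leaves : (c : GV j) → length (c ∷ leaves j) ≡ j + 3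
length-∷-leaves {j} _ = begin
  3 + length (map z' (allFin j)) ≡⟨ cong (3 +_) (length-map z' (allFin j)) ⟩
  3 + length (allFin j)          ≡⟨ cong (3 +_) (length-tabulate _) ⟩
  3 + j                          ≡⟨ +-comm 3 j ⟩
  j + 3                          ∎
  where open ≡-Reasoning

-- mag⁻(G_j) ≥ j + 3

Leaf-∈ : ∀ {O M} → IsOrientation (GE j) O → IsMAG O M → {v : GV j} → Leaf v → v ∈ M
Leaf-∈ {M = M} orientation mag ℓ with IsOrientation.edge⇒arc orientation _ _ (stem-edge ℓ)
... | inj₁ ℓ⟶stem
  with s , _ , s∈ , _ , monitored pre _ _ _ ← monitoredIn _≟ᵥ_ ∈-vertices mag ℓ⟶stem =
  subst (_∈ M) (walk-to-source (source-of-pendant orientation (stem-unique ℓ ∘ swap) ℓ⟶stem) pre) s∈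
... | inj₂ stem⟶ℓ
  with _ , t , _ , t∈ , monitored _ _ post _ ← monitoredIn _≟ᵥ_ ∈-vertices mag stem⟶ℓ =
  subst (_∈ M) (walk-from-sink (sink-of-pendant orientation (stem-unique ℓ) stem⟶ℓ) post) t∈

module MonitoredByLeaves
  {j : ℕ} {O : GV j → GV j → Bool} (orientation : IsOrientation (GE j) O) (x⟶y : Arc O x y)
  (leaf-monitored : ∀ {u w} → Arc O u w →
                    ∃[ s ] ∃[ t ] Leaf s × Leaf t × Monitored O s t u w)
  where

  open IsOrientation orientation

  infix 4 _⟶_
  _⟶_ : GV j → GV j → Set
  u ⟶ v = Arc O u v

  private variable
    p q : GV j

  orient : GE j p q → p ⟶ q ⊎ q ⟶ p
  orient = edge⇒arc _ _

  out-edge : p ⟶ q → GE j p q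
  out-edge = arc⇒edge _ _

  in-edge : q ⟶ p → GE j p q
  in-edge = swap ∘ out-edge

  anti : p ⟶ q → q ⟶ p → ⊥
  anti = antisym _ _

  -- The ends of each geodesic are leaves, so it extends beyond the ends of an arc between cores.
  entering : Core p → p ⟶ q → ∃[ r ] r ⟶ p × Monitoring O r q p q 2
  entering core d with _ , _ , ℓ , _ , m ← leaf-monitored d = step-before m (leaf≢core ℓ core)

  leaving : Core q → p ⟶ q → ∃[ r ] q ⟶ r × Monitoring O p r p q 2
  leaving core d with _ , _ , _ , ℓ , m ← leaf-monitored d = step-after m (leaf≢core ℓ core)

  passing : Core p → Core q → p ⟶ q →
            ∃[ r ] ∃[ r' ] r ⟶ p × q ⟶ r' × Monitoring O r r' p q 3
  passing core-p core-q d with _ , _ , ℓ , ℓ' , m ← leaf-monitored d =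
    steps-around m (leaf≢core ℓ core-p) (leaf≢core ℓ' core-q)

  entering₂ : Core p → p ⟶ q →
              ∃[ r ] r ⟶ p × (Core r → ∃[ r' ] r' ⟶ r × Monitoring O r' q p q 3)
  entering₂ core d with _ , _ , ℓ , _ , m ← leaf-monitored d
                   with two-steps-before m (leaf≢core ℓ core)
  ... | r , e , inj₁ refl = r , e , λ core-r → ⊥-elim (leaf≢core ℓ core-r refl)
  ... | r , e , inj₂ rest = r , e , λ _ → rest

  leaving₂ : Core q → p ⟶ q →
             ∃[ r ] q ⟶ r × (Core r → ∃[ r' ] r ⟶ r' × Monitoring O p r' p q 3)
  leaving₂ core d with _ , _ , _ , ℓ , m ← leaf-monitored d
                  with two-steps-after m (leaf≢core ℓ core)
  ... | r , e , inj₁ refl = r , e , λ core-r → ⊥-elim (leaf≢core ℓ core-r refl)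
  ... | r , e , inj₂ rest = r , e , λ _ → rest

  x⟶z⇒z⟶z' : x ⟶ z i → z i ⟶ z' i
  x⟶z⇒z⟶z' d with leaving (cz _) d
  ... | _ , e , g with neighbours-z (out-edge e)
  ...   | inj₁ refl        = ⊥-elim (anti d e)
  ...   | inj₂ (inj₁ refl) = ⊥-elim (shortcut g (x⟶y ∷ []))
  ...   | inj₂ (inj₂ refl) = e

  z⟶y⇒z'⟶z : z i ⟶ y → z' i ⟶ z i
  z⟶y⇒z'⟶z d with entering (cz _) d
  ... | _ , e , g with neighbours-z (in-edge e)
  ...   | inj₁ refl        = ⊥-elim (shortcut g (x⟶y ∷ []))
  ...   | inj₂ (inj₁ refl) = ⊥-elim (anti d e)
  ...   | inj₂ (inj₂ refl) = e

  ¬x⟶z⟶y : x ⟶ z i → ¬ z i ⟶ y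
  ¬x⟶z⟶y d e = anti (x⟶z⇒z⟶z' d) (z⟶y⇒z'⟶z e)

  x⟶z⇒y⟶z : x ⟶ z i → y ⟶ z i
  x⟶z⇒y⟶z {i = i} d with orient (inj₂ (zy i))
  ... | inj₁ y⟶z = y⟶z
  ... | inj₂ z⟶y = ⊥-elim (¬x⟶z⟶y d z⟶y)

  z⟶y⇒z⟶x : z i ⟶ y → z i ⟶ x
  z⟶y⇒z⟶x {i = i} d with orient (inj₁ (xz i))
  ... | inj₁ x⟶z = ⊥-elim (¬x⟶z⟶y x⟶z d)
  ... | inj₂ z⟶x = z⟶x

  Below Above Cyclic : Fin j → Set
  Below  i = x ⟶ z i × y ⟶ z i
  Above  i = z i ⟶ x × z i ⟶ y
  Cyclic i = y ⟶ z i × z i ⟶ x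

  trichotomy : ∀ i → Below i ⊎ Above i ⊎ Cyclic i
  trichotomy i with orient (inj₁ (xz i)) | orient (inj₁ (zy i))
  ... | inj₁ x⟶z | _        = inj₁ (x⟶z , x⟶z⇒y⟶z x⟶z)
  ... | inj₂ z⟶x | inj₁ z⟶y = inj₂ (inj₁ (z⟶x , z⟶y))
  ... | inj₂ z⟶x | inj₂ y⟶z = inj₂ (inj₂ (y⟶z , z⟶x))

  below⇒¬y⟶y' : Below i → ¬ y ⟶ y'
  below⇒¬y⟶y' (x⟶z , y⟶z) y⟶y' with entering cy y⟶z
  ... | _ , e , g with neighbours-y (in-edge e)
  ...   | inj₁ refl             = anti y⟶y' e
  ...   | inj₂ (inj₁ refl)      = shortcut g (x⟶z ∷ [])
  ...   | inj₂ (inj₂ (_ , refl)) with detour g (z⟶y⇒z⟶x e ∷ x⟶z ∷ [])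
  ...     | there _ (there _ ())

  above⇒¬x'⟶x : Above i → ¬ x' ⟶ x
  above⇒¬x'⟶x (z⟶x , z⟶y) x'⟶x with leaving cx z⟶x
  ... | _ , e , g with neighbours-x (out-edge e)
  ...   | inj₁ refl             = anti x'⟶x e
  ...   | inj₂ (inj₁ refl)      = shortcut g (z⟶y ∷ [])
  ...   | inj₂ (inj₂ (_ , refl)) with detour g (z⟶y ∷ x⟶z⇒y⟶z e ∷ [])
  ...     | there _ (there _ ())

  cyclic∧z⟶z'⇒¬x'⟶x : Cyclic i → z i ⟶ z' i → ¬ x' ⟶ x
  cyclic∧z⟶z'⇒¬x'⟶x (y⟶z , z⟶x) z⟶z' x'⟶x with passing (cz _) cx z⟶x
  ... | _ , _ , e , f , g with neighbours-z (in-edge e)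
  ...   | inj₁ refl        = anti z⟶x e
  ...   | inj₂ (inj₂ refl) = anti z⟶z' e
  ...   | inj₂ (inj₁ refl) with neighbours-x (out-edge f)
  ...     | inj₁ refl             = anti x'⟶x f
  ...     | inj₂ (inj₁ refl)      = shortcut g []
  ...     | inj₂ (inj₂ (_ , refl)) = shortcut g (x⟶z⇒y⟶z f ∷ [])

  cyclic∧z'⟶z⇒¬y⟶y' : Cyclic i → z' i ⟶ z i → ¬ y ⟶ y'
  cyclic∧z'⟶z⇒¬y⟶y' (y⟶z , z⟶x) z'⟶z y⟶y' with passing cy (cz _) y⟶z
  ... | _ , _ , e , f , g with neighbours-z (out-edge f)
  ...   | inj₂ (inj₁ refl) = anti y⟶z f
  ...   | inj₂ (inj₂ refl) = anti z'⟶z f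
  ...   | inj₁ refl with neighbours-y (in-edge e)
  ...     | inj₁ refl             = anti y⟶y' e
  ...     | inj₂ (inj₁ refl)      = shortcut g []
  ...     | inj₂ (inj₂ (_ , refl)) = shortcut g (z⟶y⇒z⟶x e ∷ [])

  y'⟶y⇒cyclic∧z⟶z' : y' ⟶ y → ∃[ i ] Cyclic i × z i ⟶ z' i
  y'⟶y⇒cyclic∧z⟶z' y'⟶y with leaving₂ cy x⟶y
  ... | _ , e , next with neighbours-y (out-edge e)
  ...   | inj₁ refl        = ⊥-elim (anti y'⟶y e)
  ...   | inj₂ (inj₁ refl) = ⊥-elim (anti x⟶y e)
  ...   | inj₂ (inj₂ (i , refl)) with next (cz i)
  ...     | _ , f , g with orient (inj₁ (xz i))
  ...       | inj₁ x⟶z = ⊥-elim (shortcut g (x⟶z ∷ f ∷ []))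
  ...       | inj₂ z⟶x with neighbours-z (out-edge f)
  ...         | inj₁ refl        = ⊥-elim (shortcut g [])
  ...         | inj₂ (inj₁ refl) = ⊥-elim (anti e f)
  ...         | inj₂ (inj₂ refl) = i , (e , z⟶x) , f

  x⟶x'⇒cyclic∧z'⟶z : x ⟶ x' → ∃[ i ] Cyclic i × z' i ⟶ z i
  x⟶x'⇒cyclic∧z'⟶z x⟶x' with entering₂ cx x⟶y
  ... | _ , e , previous with neighbours-x (in-edge e)
  ...   | inj₁ refl        = ⊥-elim (anti x⟶x' e)
  ...   | inj₂ (inj₁ refl) = ⊥-elim (anti x⟶y e)
  ...   | inj₂ (inj₂ (i , refl)) with previous (cz i)
  ...     | _ , f , g with orient (inj₁ (zy i))
  ...       | inj₁ z⟶y = ⊥-elim (shortcut g (f ∷ z⟶y ∷ []))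
  ...       | inj₂ y⟶z with neighbours-z (in-edge f)
  ...         | inj₁ refl        = ⊥-elim (anti e f)
  ...         | inj₂ (inj₁ refl) = ⊥-elim (shortcut g [])
  ...         | inj₂ (inj₂ refl) = i , (y⟶z , e) , f

  ¬cyclic-both-ways : ∀ {i i'} → Cyclic i → z i ⟶ z' i → Cyclic i' → z' i' ⟶ z i' → ⊥
  ¬cyclic-both-ways (_ , z⟶x) z⟶z' (y⟶z₂ , z₂⟶x) z₂'⟶z₂ with entering (cz _) z⟶x
  ... | _ , e , g with neighbours-z (in-edge e)
  ...   | inj₁ refl        = anti z⟶x e
  ...   | inj₂ (inj₂ refl) = anti z⟶z' e
  ...   | inj₂ (inj₁ refl) with detour g (y⟶z₂ ∷ z₂⟶x ∷ [])
  ...     | there _ (here _ _) = anti z⟶z' z₂'⟶z₂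

  impossible : Fin j → ⊥
  impossible i with orient (inj₂ x'x) | orient (inj₁ yy')
  ... | inj₂ x'⟶x | inj₁ y⟶y' with trichotomy i
  ...   | inj₁ below        = below⇒¬y⟶y' below y⟶y'
  ...   | inj₂ (inj₁ above) = above⇒¬x'⟶x above x'⟶x
  ...   | inj₂ (inj₂ cyclic) with orient (inj₁ (zz' i))
  ...     | inj₁ z⟶z' = cyclic∧z⟶z'⇒¬x'⟶x cyclic z⟶z' x'⟶x
  ...     | inj₂ z'⟶z = cyclic∧z'⟶z⇒¬y⟶y' cyclic z'⟶z y⟶y'
  impossible i | inj₂ x'⟶x | inj₂ y'⟶y
    with _ , cyclic , z⟶z' ← y'⟶y⇒cyclic∧z⟶z' y'⟶y = cyclic∧z⟶z'⇒¬x'⟶x cyclic z⟶z' x'⟶x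
  impossible i | inj₁ x⟶x' | inj₁ y⟶y'
    with _ , cyclic , z'⟶z ← x⟶x'⇒cyclic∧z'⟶z x⟶x' = cyclic∧z'⟶z⇒¬y⟶y' cyclic z'⟶z y⟶y'
  impossible i | inj₁ x⟶x' | inj₂ y'⟶y
    with _ , c , z⟶z' ← y'⟶y⇒cyclic∧z⟶z' y'⟶y | _ , c' , z'⟶z ← x⟶x'⇒cyclic∧z'⟶z x⟶x' =
    ¬cyclic-both-ways c z⟶z' c' z'⟶z

core? : (v : GV j) → Dec (Core v)
core? v with leaf-or-core v
... | inj₁ ℓ    = no λ core → leaf≢core ℓ core refl
... | inj₂ core = yes core

core-∈ : ∀ {O M} → IsOrientation (GE j) O → Arc O x y → IsMAG O M → Fin j →
         ∃[ c ] Core c × c ∈ M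
core-∈ {O = O} {M = M} orientation x⟶y mag i with any? core? M
... | yes has-core = let c , c∈ , core = find has-core in c , core , c∈
... | no  no-core  = ⊥-elim (MonitoredByLeaves.impossible orientation x⟶y leaf-monitored i)
  where
  leaf : ∀ {v} → v ∈ M → Leaf v
  leaf {v} v∈ with leaf-or-core v
  ... | inj₁ ℓ    = ℓ
  ... | inj₂ core = ⊥-elim (no-core (lose v∈ core))

  leaf-monitored : ∀ {u w} → Arc O u w →
                   ∃[ s ] ∃[ t ] Leaf s × Leaf t × Monitored O s t u w
  leaf-monitored d with s , t , s∈ , t∈ , m ← monitoredIn _≟ᵥ_ ∈-vertices mag d =
    s , t , leaf s∈ , leaf t∈ , m

lower-bound-x⟶y : ∀ {O M} → Fin j → IsOrientation (GE j) O → IsMAG O M → Arc O x y →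
                  j + 3 ≤ length M
lower-bound-x⟶y {M = M} i orientation mag x⟶y
  with c , core , c∈ ← core-∈ orientation x⟶y mag i =
  subst (_≤ length M) (length-∷-leaves c) (Unique⇒length≤ (Unique-∷-leaves core) ⊆M)
  where
  ⊆M : ∀ {v} → v ∈ c ∷ leaves _ → v ∈ M
  ⊆M (here refl) = c∈
  ⊆M (there v∈)  = Leaf-∈ orientation mag (leaves-Leaf v∈)

lower-bound : ∀ {O M} → Fin j → IsOrientation (GE j) O → IsMAG O M → j + 3 ≤ length M
lower-bound i orientation mag with IsOrientation.edge⇒arc orientation x y (inj₁ xy)
... | inj₁ x⟶y = lower-bound-x⟶y i orientation mag x⟶y
... | inj₂ y⟶x =
  lower-bound-x⟶y i (IsOrientation-flip swap orientation) (IsMAG-flip mag) y⟶x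

-- An orientation of G_j with an MAG-set of size j + 3

module UpperBound (n : ℕ) where

  -- Missing clauses below are those of non-arcs, where an argument has type false ≡ true.
  O⁺ : GV (suc n) → GV (suc n) → Bool
  O⁺ x'       x           = true
  O⁺ x        y           = true
  O⁺ y        y'          = true
  O⁺ x        (z _)       = true
  O⁺ (z i)    (z' i')     = does (i Fin.≟ i')
  O⁺ (z zero) y           = true
  O⁺ y        (z (suc _)) = true
  O⁺ _        _           = false

  arc⇒edge⁺ : ∀ u v → Arc O⁺ u v → GE (suc n) u v
  arc⇒edge⁺ x'       x           _ = inj₁ x'x
  arc⇒edge⁺ x        y           _ = inj₁ xy
  arc⇒edge⁺ y        y'          _ = inj₁ yy'
  arc⇒edge⁺ x        (z i)       _ = inj₁ (xz i)
  arc⇒edge⁺ (z zero) y           _ = inj₁ (zy zero)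
  arc⇒edge⁺ y        (z (suc i)) _ = inj₂ (zy (suc i))
  arc⇒edge⁺ (z i)    (z' i')     d with i Fin.≟ i'
  ... | yes refl = inj₁ (zz' i)
  arc⇒edge⁺ (z i)    (z' i')     () | no _

  base⇒arc⁺ : {u v : GV (suc n)} → GBase u v → Arc O⁺ u v ⊎ Arc O⁺ v u
  base⇒arc⁺ x'x          = inj₁ refl
  base⇒arc⁺ xy           = inj₁ refl
  base⇒arc⁺ yy'          = inj₁ refl
  base⇒arc⁺ (xz i)       = inj₁ refl
  base⇒arc⁺ (zy zero)    = inj₁ refl
  base⇒arc⁺ (zy (suc i)) = inj₂ refl
  base⇒arc⁺ (zz' i)      = inj₁ (dec-true (i Fin.≟ i) refl)

  base-antisym⁺ : {u v : GV (suc n)} → GBase u v → Arc O⁺ u v → ¬ Arc O⁺ v u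
  base-antisym⁺ (zy zero)    _  ()
  base-antisym⁺ (zy (suc i)) () _

  orientation⁺ : IsOrientation (GE (suc n)) O⁺
  orientation⁺ = record
    { arc⇒edge = arc⇒edge⁺
    ; edge⇒arc = λ { _ _ (inj₁ b) → base⇒arc⁺ b ; _ _ (inj₂ b) → swap (base⇒arc⁺ b) }
    ; antisym  = λ u v d e → Sum.[ (λ b → base-antisym⁺ b d e) , (λ b → base-antisym⁺ b e d) ]′
                                   (arc⇒edge⁺ u v d)
    }

  out-x' : ∀ {v} → Arc O⁺ x' v → v ≡ x
  out-x' d = stem-unique lx' (arc⇒edge⁺ _ _ d)

  into-y' : ∀ {v} → Arc O⁺ v y' → v ≡ y
  into-y' d = stem-unique ly' (swap (arc⇒edge⁺ _ _ d))

  into-z' : ∀ {v i} → Arc O⁺ v (z' i) → v ≡ z i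
  into-z' d = stem-unique (lz' _) (swap (arc⇒edge⁺ _ _ d))

  via-xy : (p : Walk O⁺ x' y' k) → k ≤ 3 → ArcOn x y p
  via-xy (_∷_ {v = x} d₁ (_∷_ {v = y} d₂ (d₃ ∷ []))) _ = there d₁ (here d₂ (d₃ ∷ []))
  via-xy (_ ∷ _ ∷ _ ∷ _ ∷ _) (s≤s (s≤s (s≤s ())))

  via-xz : ∀ {i} (p : Walk O⁺ x' (z' i) k) → k ≤ 3 → ArcOn x (z i) p
  via-xz {i = i} (_∷_ {v = x} d₁ (_∷_ {v = v} d₂ (d₃ ∷ []))) _
    with refl ← into-z' {v} {i} d₃ = there d₁ (here d₂ (d₃ ∷ []))
  via-xz (_ ∷ _ ∷ _ ∷ _ ∷ _) (s≤s (s≤s (s≤s ())))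

  via-zy : (p : Walk O⁺ (z zero) y' k) → k ≤ 2 → ArcOn (z zero) y p
  via-zy (_∷_ {v = v} d₁ (d₂ ∷ [])) _ with refl ← into-y' {v} d₂ = here d₁ (d₂ ∷ [])
  via-zy (_ ∷ _ ∷ _ ∷ _) (s≤s (s≤s ()))

  via-yz : ∀ {i} (p : Walk O⁺ (z zero) (z' (suc i)) k) → k ≤ 3 → ArcOn y (z (suc i)) p
  via-yz {i = i} (_∷_ {v = y} d₁ (_∷_ {v = v} d₂ (d₃ ∷ []))) _
    with refl ← into-z' {v} {suc i} d₃ = there d₁ (here d₂ (d₃ ∷ []))
  via-yz (_ ∷ _ ∷ _ ∷ _ ∷ _) (s≤s (s≤s (s≤s ())))

  x'xyy' : Walk O⁺ x' y' 3
  x'xyy' = _∷_ {v = x} refl (_∷_ {v = y} refl (refl ∷ []))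

  x'xzz' : ∀ i → Walk O⁺ x' (z' i) 3
  x'xzz' i = _∷_ {v = x} refl (_∷_ {v = z i} refl (dec-true (i Fin.≟ i) refl ∷ []))

  z₀yy' : Walk O⁺ (z zero) y' 2
  z₀yy' = _∷_ {v = y} refl (refl ∷ [])

  z₀yzz' : ∀ i → Walk O⁺ (z zero) (z' (suc i)) 3
  z₀yzz' i =
    _∷_ {v = y} refl (_∷_ {v = z (suc i)} refl (dec-true (suc i Fin.≟ suc i) refl ∷ []))

  M⁺ : List (GV (suc n))
  M⁺ = z zero ∷ leaves (suc n)

  leaf-∈-M⁺ : ∀ {v} → Leaf v → v ∈ M⁺
  leaf-∈-M⁺ = there ∘ Leaf-∈-leaves

  monitoring-pair : ∀ {s t a b k} → s ∈ M⁺ → t ∈ M⁺ → s ≢ t → (p : Walk O⁺ s t k) →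
                    (∀ {n} (q : Walk O⁺ s t n) → n ≤ k → ArcOn a b q) →
                    ∃[ s ] ∃[ t ] s ∈ M⁺ × t ∈ M⁺ × Monitors O⁺ s t a b
  monitoring-pair s∈ t∈ s≢t p through = _ , _ , s∈ , t∈ , s≢t , inj₁ (OnAllShortest-intro p through)

  mag⁺ : IsMAG O⁺ M⁺
  mag⁺ u v d with arc⇒edge⁺ u v d
  ... | inj₁ x'x =
    monitoring-pair (leaf-∈-M⁺ lx') (leaf-∈-M⁺ ly') (λ ()) x'xyy' λ q _ → ArcOn-start out-x' q λ ()
  ... | inj₁ xy =
    monitoring-pair (leaf-∈-M⁺ lx') (leaf-∈-M⁺ ly') (λ ()) x'xyy' via-xy
  ... | inj₁ yy' =
    monitoring-pair (leaf-∈-M⁺ lx') (leaf-∈-M⁺ ly') (λ ()) x'xyy' λ q _ → ArcOn-end into-y' q λ ()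
  ... | inj₁ (xz i) =
    monitoring-pair (leaf-∈-M⁺ lx') (leaf-∈-M⁺ (lz' i)) (λ ()) (x'xzz' i) via-xz
  ... | inj₁ (zy zero) =
    monitoring-pair (here refl) (leaf-∈-M⁺ ly') (λ ()) z₀yy' via-zy
  ... | inj₂ (zy (suc i)) =
    monitoring-pair (here refl) (leaf-∈-M⁺ (lz' (suc i))) (λ ()) (z₀yzz' i) via-yz
  ... | inj₁ (zz' i) =
    monitoring-pair (leaf-∈-M⁺ lx') (leaf-∈-M⁺ (lz' i)) (λ ()) (x'xzz' i) λ q _ →
      ArcOn-end into-z' q λ ()

theorem4 : ∀ (j : ℕ) → 1 ≤ j → MagMinusIs (GE j) (j + 3)
theorem4 (suc n) _ =
  (O⁺ , orientation⁺ , M⁺ , Unique-∷-leaves (cz zero) , length-∷-leaves (z zero) , mag⁺) ,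
  λ _ orientation _ _ mag → lower-bound zero orientation mag
  where open UpperBound n
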